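{- Let $D$ be an oriented graph and let $p$ be an integer. If $D$ is $(=p)$-invertible, then $\mathrm{inv}^{= p}(D) \leq |A(D)|$.
   Context: For an oriented graph $D$ and $X\subseteq V(D)$, the inversion of $X$ reverses the orientation of every arc with both endpoints in $X$. A $(=p)$-inversion is the inversion of a set of exactly $p$ vertices. $D$ is $(=p)$-invertible if it can be made acyclic by a sequence of $(=p)$-inversions, and $\mathrm{inv}^{=p}(D)$ is the minimum number of $(=p)$-inversions whose successive application makes $D$ acyclic ($+\infty$ if none exists). $A(D)$ is the arc set of $D$. -}

module Defs where

open import Data.Nat using (ℕ; suc; _+_; _≤_)
open import Data.Integer using (ℤ; +_)
open import Data.Bool using (Bool; true; false; if_then_else_; _∧_)
open import Data.Fin using (Fin; zero; suc; inject₁; fromℕ)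
import Data.Unit
open import Data.Fin.Subset using (Subset; ∣_∣)
open import Data.Vec using (lookup)
open import Data.List using (List; []; _∷_; length; map; allFin)
open import Data.Nat.ListAction using (sum)
open import Data.Product using (Σ; ∃; ∃-syntax; _×_; _,_)
open import Data.Empty using (⊥)
open import Relation.Nullary using (¬_)
open import Relation.Binary.PropositionalEquality using (_≡_)
open import Function.Definitions using (Injective)

-- A binary relation on vertices Fin n, given as a Boolean adjacency function:
-- arc u v ≡ true  means  (u , v) ∈ A(D).
ArcRel : ℕ → Set
ArcRel n = Fin n → Fin n → Bool

record OrientedGraph : Set where
  field
    n       : ℕ
    arc     : ArcRel n
    irrefl  : ∀ u → arc u u ≡ false
    antisym : ∀ u v → arc u v ≡ true → arc v u ≡ false
open OrientedGraph public

invert : ∀ {n} → Subset n → ArcRel n → ArcRel n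
invert X r u v = if (lookup X u ∧ lookup X v) then r v u else r u v

applySeq : ∀ {n} → List (Subset n) → ArcRel n → ArcRel n
applySeq []       r = r
applySeq (X ∷ Xs) r = applySeq Xs (invert X r)

-- A directed cycle of length k+1 in r: distinct vertices c 0, ..., c k with
-- arcs c i → c (i+1) for i < k and the closing arc c k → c 0.
record DirectedCycle {n : ℕ} (r : ArcRel n) : Set where
  field
    k        : ℕ
    c        : Fin (suc k) → Fin n
    distinct : Injective _≡_ _≡_ c
    step     : ∀ (i : Fin k) → r (c (inject₁ i)) (c (suc i)) ≡ true
    close    : r (c (fromℕ k)) (c zero) ≡ true

Acyclic : ∀ {n} → ArcRel n → Set
Acyclic r = ¬ DirectedCycle r

AllSize : ∀ {n} → ℤ → List (Subset n) → Set
AllSize p []       = Data.Unit.⊤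
AllSize p (X ∷ Xs) = (+ ∣ X ∣ ≡ p) × AllSize p Xs

MakesAcyclic : (p : ℤ) (D : OrientedGraph) → List (Subset (n D)) → Set
MakesAcyclic p D Xs = AllSize p Xs × Acyclic (applySeq Xs (arc D))

Invertible : ℤ → OrientedGraph → Set
Invertible p D = ∃[ Xs ] MakesAcyclic p D Xs

IsInv : ℤ → OrientedGraph → ℕ → Set
IsInv p D m = (∃[ Xs ] (MakesAcyclic p D Xs × length Xs ≡ m))
            × (∀ Xs → MakesAcyclic p D Xs → m ≤ length Xs)

arcCount : OrientedGraph → ℕ
arcCount D = sum (map (λ u → sum (map (λ v → if arc D u v then 1 else 0) (allFin (n D)))) (allFin (n D)))

-- Record an inversion X as the GF(2)-vector of pairs {u, v} ⊆ X. After a sequence of inversions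
-- the orientation of each pair depends only on the sum of these vectors at that pair, and a pair
-- that carries no arc of D stays arcless whatever that sum is. So only the |A(D)| coordinates
-- indexed by arcs of D matter: in a sequence of more than |A(D)| inversions the restricted vectors
-- are linearly dependent, and deleting a nonempty subsequence with zero sum leaves the resulting
-- digraph unchanged. Hence some optimal sequence has length at most |A(D)|; the minimum itself
-- exists because acyclicity, and hence solvability with a given number of inversions, is decidable.
module Submission where

open import Defs
open import Data.Nat using (ℕ; zero; suc; _+_; _≤_; _<_; z≤n; s≤s; _≤?_)
open import Data.Nat.Properties using (≤-refl; ≤-trans; <-≤-trans; n≤1+n; m<m+n; ≮⇒≥; ≰⇒>; anyUpTo?)
open import Data.Nat.Induction using (<-wellFounded)
open import Data.Nat.ListAction using (sum)
open import Data.Integer using (ℤ; +_)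
import Data.Integer.Properties as ℤ
open import Data.Bool using (Bool; true; false; _∧_; _xor_; if_then_else_)
open import Data.Bool.Properties
  using (xor-assoc; xor-comm; xor-same; xor-identityʳ; not-distribʳ-xor; ∧-comm; ∧-identityʳ;
         ∧-distribʳ-xor; ¬-not; if-not; if-eta)
  renaming (_≟_ to _≟ᵇ_)
open import Data.Fin using (Fin; zero; suc; inject₁; fromℕ; punchIn; punchOut)
open import Data.Fin.Properties using (any?; all?; punchIn-punchOut; injective⇒≤) renaming (_≟_ to _≟ᶠ_)
open import Data.Fin.Subset using (Subset; ∣_∣)
open import Data.Fin.Subset.Properties using (anySubset?)
open import Data.Vec using (Vec; []; _∷_; lookup; tabulate; toList; fromList)
open import Data.Vec.Properties using (lookup∘tabulate; length-toList; toList∘fromList)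
open import Data.List using (List; []; _∷_; [_]; length; map; allFin; concatMap)
import Data.List as List
open import Data.List.Properties using (length-++; map-cong)
open import Data.List.Membership.Propositional using (_∈_)
open import Data.List.Membership.Propositional.Properties using (∈-allFin; ∈-concatMap⁺)
open import Data.List.Relation.Unary.Any using (here; there; index)
import Data.List.Relation.Unary.Any as Any
open import Data.List.Relation.Unary.Any.Properties using (lookup-index)
open import Data.List.Relation.Binary.Pointwise using (≡⇒Pointwise-≡)
open import Data.List.Relation.Ternary.Interleaving.Propositional using (Interleaving; []; left; consˡ; consʳ)
open import Data.List.Relation.Ternary.Interleaving.Properties using (interleave-length)
open import Data.Product using (∃; ∃₂; ∃-syntax; _×_; _,_)
open import Data.Unit using (tt)
open import Function using (_∘_; _⇔_; mk⇔)
open import Induction.WellFounded using (Acc; acc)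
open import Level using (0ℓ)
open import Relation.Nullary using (Dec; yes; no; ¬?; _×-dec_; _→-dec_)
import Relation.Nullary.Decidable as Dec
open import Relation.Unary using (Pred; Decidable)
open import Relation.Binary.PropositionalEquality
  using (_≡_; refl; sym; trans; cong; cong₂; subst; subst₂; _≗_; module ≡-Reasoning)
open ≡-Reasoning

xor-left-comm : ∀ a b c → a xor (b xor c) ≡ b xor (a xor c)
xor-left-comm false b c = refl
xor-left-comm true  b c = not-distribʳ-xor b c

xor-interchange : ∀ a b c d → (a xor b) xor (c xor d) ≡ (a xor c) xor (b xor d)
xor-interchange a b c d = begin
  (a xor b) xor (c xor d)  ≡⟨ xor-assoc a b (c xor d) ⟩
  a xor (b xor (c xor d))  ≡⟨ cong (a xor_) (xor-left-comm b c d) ⟩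
  a xor (c xor (b xor d))  ≡⟨ xor-assoc a c (b xor d) ⟨
  (a xor c) xor (b xor d)  ∎

module _ {A C : Set} where

  xorSum : (A → C → Bool) → List A → C → Bool
  xorSum v []       c = false
  xorSum v (x ∷ xs) c = v x c xor xorSum v xs c

  xorSum-interleaving : ∀ v {xs ys zs} → Interleaving ys zs xs → ∀ c →
                        xorSum v xs c ≡ xorSum v ys c xor xorSum v zs c
  xorSum-interleaving v []            c = refl
  xorSum-interleaving v {x ∷ _} (consˡ split) c =
    trans (cong (v x c xor_) (xorSum-interleaving v split c)) (sym (xor-assoc (v x c) _ _))
  xorSum-interleaving v {x ∷ _} {ys} {_ ∷ zs} (consʳ split) c =
    trans (cong (v x c xor_) (xorSum-interleaving v split c)) (xor-left-comm (v x c) (xorSum v ys c) _)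

  -- One step of Gaussian elimination: add w to every vector whose c₀-coordinate is 1.
  eliminate : C → (C → Bool) → (A → C → Bool) → A → C → Bool
  eliminate c₀ w v a c = v a c xor (v a c₀ ∧ w c)

  xorSum-eliminate : ∀ c₀ w v xs c →
                     xorSum (eliminate c₀ w v) xs c ≡ xorSum v xs c xor (xorSum v xs c₀ ∧ w c)
  xorSum-eliminate c₀ w v []       c = refl
  xorSum-eliminate c₀ w v (x ∷ xs) c = begin
    (v x c xor (v x c₀ ∧ w c)) xor xorSum (eliminate c₀ w v) xs c
      ≡⟨ cong ((v x c xor (v x c₀ ∧ w c)) xor_) (xorSum-eliminate c₀ w v xs c) ⟩
    (v x c xor (v x c₀ ∧ w c)) xor (xorSum v xs c xor (xorSum v xs c₀ ∧ w c))
      ≡⟨ xor-interchange (v x c) (v x c₀ ∧ w c) (xorSum v xs c) _ ⟩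
    (v x c xor xorSum v xs c) xor ((v x c₀ ∧ w c) xor (xorSum v xs c₀ ∧ w c))
      ≡⟨ cong ((v x c xor xorSum v xs c) xor_) (∧-distribʳ-xor (w c) (v x c₀) (xorSum v xs c₀)) ⟨
    (v x c xor xorSum v xs c) xor ((v x c₀ xor xorSum v xs c₀) ∧ w c)
      ∎

  xorSum-eliminate-pivot : ∀ c₀ w v xs → w c₀ ≡ true → xorSum (eliminate c₀ w v) xs c₀ ≡ false
  xorSum-eliminate-pivot c₀ w v xs pivot
    rewrite xorSum-eliminate c₀ w v xs c₀ | pivot | ∧-identityʳ (xorSum v xs c₀) = xor-same (xorSum v xs c₀)

  -- x joins the selection exactly when the selected vectors have c₀-coordinate sum 1.
  eliminate-lift : ∀ c₀ v x {xs ys zs} → Interleaving ys zs xs →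
                 ∃₂ λ ys′ zs′ → Interleaving ys′ zs′ (x ∷ xs) × length zs ≤ length zs′
                              × (∀ c → xorSum v zs′ c ≡ xorSum (eliminate c₀ (v x) v) zs c)
  eliminate-lift c₀ v x {zs = zs} split with xorSum v zs c₀ in coefficient
  ... | true  = _ , _ , consʳ split , n≤1+n _ , λ c → begin
    v x c xor xorSum v zs c                        ≡⟨ xor-comm (v x c) _ ⟩
    xorSum v zs c xor v x c                        ≡⟨ cong (λ b → xorSum v zs c xor (b ∧ v x c)) coefficient ⟨
    xorSum v zs c xor (xorSum v zs c₀ ∧ v x c)     ≡⟨ xorSum-eliminate c₀ (v x) v zs c ⟨
    xorSum (eliminate c₀ (v x) v) zs c             ∎
  ... | false = _ , _ , consˡ split , ≤-refl , λ c → begin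
    xorSum v zs c                                  ≡⟨ xor-identityʳ _ ⟨
    xorSum v zs c xor false                        ≡⟨ cong (λ b → xorSum v zs c xor (b ∧ v x c)) coefficient ⟨
    xorSum v zs c xor (xorSum v zs c₀ ∧ v x c)     ≡⟨ xorSum-eliminate c₀ (v x) v zs c ⟨
    xorSum (eliminate c₀ (v x) v) zs c             ∎

  ZeroSumSplit : (A → C → Bool) → ∀ {k} → (Fin k → C) → List A → Set
  ZeroSumSplit v cs xs = ∃₂ λ ys zs → Interleaving ys zs xs × 0 < length zs
                                    × (∀ i → xorSum v zs (cs i) ≡ false)

  zeroSumSplit-singleton : ∀ v {k} (cs : Fin k → C) x xs →
                           (∀ i → v x (cs i) ≡ false) → ZeroSumSplit v cs (x ∷ xs)
  zeroSumSplit-singleton v cs x xs x-vanishes =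
    xs , [ x ] , consʳ (left (≡⇒Pointwise-≡ refl)) , s≤s z≤n ,
    λ i → trans (xor-identityʳ _) (x-vanishes i)

  -- More vectors than coordinates are linearly dependent: eliminate along a coordinate where the
  -- first vector is nonzero and recurse on the remaining vectors and coordinates.
  zeroSumSplit : ∀ v {k} (cs : Fin k → C) xs → k < length xs → ZeroSumSplit v cs xs
  zeroSumSplit v {zero}  cs (x ∷ xs) _ = zeroSumSplit-singleton v cs x xs (λ ())
  zeroSumSplit v {suc k} cs (x ∷ xs) (s≤s k<|xs|) with any? (λ i → v x (cs i) ≟ᵇ true)
  ... | no no-pivot = zeroSumSplit-singleton v cs x xs (λ i → ¬-not (no-pivot ∘ (i ,_)))
  ... | yes (j , pivot)
    with _ , zs , split , nonempty , vanishes
           ← zeroSumSplit (eliminate (cs j) (v x) v) (cs ∘ punchIn j) xs k<|xs|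
    with ys′ , zs′ , split′ , grows , same ← eliminate-lift (cs j) v x split
    = ys′ , zs′ , split′ , <-≤-trans nonempty grows , vanishes′
    where
      vanishes′ : ∀ i → xorSum v zs′ (cs i) ≡ false
      vanishes′ i with j ≟ᶠ i
      ... | yes refl = trans (same (cs j)) (xorSum-eliminate-pivot (cs j) (v x) v zs pivot)
      ... | no j≢i   = trans (same (cs i))
        (subst (λ i′ → xorSum _ zs (cs i′) ≡ false) (punchIn-punchOut j≢i) (vanishes (punchOut j≢i)))

bothIn : ∀ {n} → Subset n → Fin n × Fin n → Bool
bothIn X (u , v) = lookup X u ∧ lookup X v

flipped : ∀ {n} → List (Subset n) → Fin n × Fin n → Bool
flipped = xorSum bothIn

flipped-sym : ∀ {n} (Xs : List (Subset n)) u v → flipped Xs (v , u) ≡ flipped Xs (u , v)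
flipped-sym []       u v = refl
flipped-sym (X ∷ Xs) u v = cong₂ _xor_ (∧-comm (lookup X v) (lookup X u)) (flipped-sym Xs u v)

applySeq-flipped : ∀ {n} Xs (r : ArcRel n) u v →
                   applySeq Xs r u v ≡ (if flipped Xs (u , v) then r v u else r u v)
applySeq-flipped []       r u v = refl
applySeq-flipped (X ∷ Xs) r u v
  rewrite applySeq-flipped Xs (invert X r) u v | ∧-comm (lookup X v) (lookup X u)
  with lookup X u ∧ lookup X v
... | true  = sym (if-not (flipped Xs (u , v)))
... | false = refl

-- A pair carrying no arc of r in either direction stays arcless, whatever its parity.
applySeq-cong : ∀ {n} (r : ArcRel n) Xs Ys →
                (∀ u v → r u v ≡ true → flipped Xs (u , v) ≡ flipped Ys (u , v)) →
                ∀ u v → applySeq Xs r u v ≡ applySeq Ys r u v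
applySeq-cong r Xs Ys agree u v
  rewrite applySeq-flipped Xs r u v | applySeq-flipped Ys r u v
  with r u v in uv | r v u in vu
... | true  | _     = cong (λ b → if b then _ else true) (agree u v uv)
... | false | true  = cong (λ b → if b then true else false)
  (trans (flipped-sym Xs v u) (trans (agree v u vu) (sym (flipped-sym Ys v u))))
... | false | false = trans (if-eta (flipped Xs (u , v))) (sym (if-eta (flipped Ys (u , v))))

directedCycle-resp : ∀ {n} {r r′ : ArcRel n} → (∀ u v → r u v ≡ r′ u v) →
                     DirectedCycle r → DirectedCycle r′
directedCycle-resp r≐r′ cycle = record
  { k = k ; c = c ; distinct = distinct
  ; step = λ i → trans (sym (r≐r′ _ _)) (step i)
  ; close = trans (sym (r≐r′ _ _)) close
  }
  where open DirectedCycle cycle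

arcsFrom : ∀ {n} → ArcRel n → Fin n → List (Fin n) → List (Fin n × Fin n)
arcsFrom r u []       = []
arcsFrom r u (v ∷ vs) = if r u v then (u , v) ∷ arcsFrom r u vs else arcsFrom r u vs

arcList : ∀ {n} → ArcRel n → List (Fin n × Fin n)
arcList {n} r = concatMap (λ u → arcsFrom r u (allFin n)) (allFin n)

length-concatMap : ∀ {A B : Set} (f : A → List B) xs →
                   length (concatMap f xs) ≡ sum (map (length ∘ f) xs)
length-concatMap f []       = refl
length-concatMap f (x ∷ xs) = trans (length-++ (f x)) (cong (_+_ (length (f x))) (length-concatMap f xs))

length-arcsFrom : ∀ {n} (r : ArcRel n) u vs →
                  length (arcsFrom r u vs) ≡ sum (map (λ v → if r u v then 1 else 0) vs)
length-arcsFrom r u []       = refl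
length-arcsFrom r u (v ∷ vs) with r u v
... | true  = cong suc (length-arcsFrom r u vs)
... | false = length-arcsFrom r u vs

length-arcList : ∀ D → length (arcList (arc D)) ≡ arcCount D
length-arcList D = trans (length-concatMap _ (allFin (n D)))
  (cong sum (map-cong (λ u → length-arcsFrom (arc D) u (allFin (n D))) (allFin (n D))))

∈-arcsFrom : ∀ {n} {r : ArcRel n} {u v vs} → r u v ≡ true → v ∈ vs → (u , v) ∈ arcsFrom r u vs
∈-arcsFrom {vs = _ ∷ _} uv (here refl) rewrite uv = here refl
∈-arcsFrom {r = r} {u} {vs = w ∷ _} uv (there v∈vs) with r u w
... | true  = there (∈-arcsFrom uv v∈vs)
... | false = ∈-arcsFrom uv v∈vs

arcList-index : ∀ {n} (r : ArcRel n) u v → r u v ≡ true →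
                ∃ λ i → List.lookup (arcList r) i ≡ (u , v)
arcList-index {n} r u v uv = index arc∈ , sym (lookup-index arc∈)
  where
    arc∈ : (u , v) ∈ arcList r
    arc∈ = ∈-concatMap⁺ (λ w → arcsFrom r w (allFin n))
             (Any.map (λ { refl → ∈-arcsFrom uv (∈-allFin v) }) (∈-allFin u))

AllSize-left : ∀ {n p} {Xs Ys Zs : List (Subset n)} → Interleaving Ys Zs Xs → AllSize p Xs → AllSize p Ys
AllSize-left []            _              = tt
AllSize-left (consˡ split) (size , sizes) = size , AllSize-left split sizes
AllSize-left (consʳ split) (_    , sizes) = AllSize-left split sizes

module _ (p : ℤ) (D : OrientedGraph) where

  shorten : ∀ Xs → MakesAcyclic p D Xs → arcCount D < length Xs →
            ∃ λ Ys → MakesAcyclic p D Ys × length Ys < length Xs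
  shorten Xs (sizes , acyclic) long
    with Ys , Zs , split , nonempty , vanishes
           ← zeroSumSplit bothIn (List.lookup (arcList (arc D))) Xs
               (subst (_< length Xs) (sym (length-arcList D)) long)
    = Ys , (AllSize-left split sizes , acyclic ∘ directedCycle-resp (applySeq-cong (arc D) Ys Xs agree))
    , subst (length Ys <_) (sym (interleave-length split)) (m<m+n (length Ys) nonempty)
    where
      agree : ∀ u v → arc D u v ≡ true → flipped Ys (u , v) ≡ flipped Xs (u , v)
      agree u v uv with i , at ← arcList-index (arc D) u v uv = sym (begin
        flipped Xs (u , v)                         ≡⟨ xorSum-interleaving bothIn split (u , v) ⟩
        flipped Ys (u , v) xor flipped Zs (u , v)  ≡⟨ cong (flipped Ys (u , v) xor_) Zs-vanishes ⟩
        flipped Ys (u , v) xor false               ≡⟨ xor-identityʳ _ ⟩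
        flipped Ys (u , v)                         ∎)
        where
          Zs-vanishes : flipped Zs (u , v) ≡ false
          Zs-vanishes = subst (λ e → flipped Zs e ≡ false) at (vanishes i)

  short-solution : ∀ Xs → MakesAcyclic p D Xs → ∃ λ Ys → MakesAcyclic p D Ys × length Ys ≤ arcCount D
  short-solution Xs solves = go Xs solves (<-wellFounded (length Xs))
    where
      go : ∀ Xs → MakesAcyclic p D Xs → Acc _<_ (length Xs) →
           ∃ λ Ys → MakesAcyclic p D Ys × length Ys ≤ arcCount D
      go Xs solves (acc shorter) with length Xs ≤? arcCount D
      ... | yes short = Xs , solves , short
      ... | no long with Ys , solvesY , Ys<Xs ← shorten Xs solves (≰⇒> long) =
        go Ys solvesY (shorter Ys<Xs)

Searchable : Set → Set₁
Searchable A = ∀ {P : Pred A 0ℓ} → Decidable P → Dec (∃ P)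

searchable-Vec : ∀ {A} → Searchable A → ∀ m → Searchable (Vec A m)
searchable-Vec search zero    P? = Dec.map′ ([] ,_) (λ { ([] , P[]) → P[] }) (P? [])
searchable-Vec search (suc m) P? =
  Dec.map′ (λ (x , xs , Px∷xs) → x ∷ xs , Px∷xs) (λ { (x ∷ xs , Px∷xs) → x , xs , Px∷xs })
    (search (λ x → searchable-Vec search m (P? ∘ (x ∷_))))

CycleOn : ∀ {n} → ArcRel n → (k : ℕ) → (Fin (suc k) → Fin n) → Set
CycleOn r k c = (∀ i j → c i ≡ c j → i ≡ j)
              × (∀ (i : Fin k) → r (c (inject₁ i)) (c (suc i)) ≡ true)
              × r (c (fromℕ k)) (c zero) ≡ true

cycleOn? : ∀ {n} (r : ArcRel n) k c → Dec (CycleOn r k c)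
cycleOn? r k c = all? (λ i → all? (λ j → (c i ≟ᶠ c j) →-dec (i ≟ᶠ j)))
           ×-dec all? (λ i → r (c (inject₁ i)) (c (suc i)) ≟ᵇ true)
           ×-dec (r (c (fromℕ k)) (c zero) ≟ᵇ true)

CycleOn-resp : ∀ {n} {r : ArcRel n} {k} {c c′ : Fin (suc k) → Fin n} → c ≗ c′ →
               CycleOn r k c → CycleOn r k c′
CycleOn-resp {r = r} c≗c′ (distinct , step , close) =
  (λ i j eq → distinct i j (trans (c≗c′ i) (trans eq (sym (c≗c′ j)))))
  , (λ i → subst₂ (λ a b → r a b ≡ true) (c≗c′ _) (c≗c′ _) (step i))
  , subst₂ (λ a b → r a b ≡ true) (c≗c′ _) (c≗c′ _) close

CycleVec : ∀ {n} → ArcRel n → Set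
CycleVec {n} r = ∃ λ k → k < n × ∃ λ (w : Vec (Fin n) (suc k)) → CycleOn r k (lookup w)

-- By injectivity a directed cycle has at most n vertices, which bounds the search.
cycleVec⇔directedCycle : ∀ {n} (r : ArcRel n) → CycleVec r ⇔ DirectedCycle r
cycleVec⇔directedCycle r = mk⇔ fromVec toVec
  where
    fromVec : CycleVec r → DirectedCycle r
    fromVec (k , _ , w , distinct , step , close) =
      record { k = k ; c = lookup w ; distinct = distinct _ _ ; step = step ; close = close }
    toVec : DirectedCycle r → CycleVec r
    toVec cycle = k , injective⇒≤ distinct , tabulate c
                , CycleOn-resp {r = r} (sym ∘ lookup∘tabulate c) ((λ _ _ → distinct) , step , close)
      where open DirectedCycle cycle

directedCycle? : ∀ {n} (r : ArcRel n) → Dec (DirectedCycle r)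
directedCycle? {n} r =
  Dec.map (cycleVec⇔directedCycle r) (anyUpTo? (λ k → searchable-Vec any? (suc k) (cycleOn? r k ∘ lookup)) n)

allSize? : ∀ {n} p (Xs : List (Subset n)) → Dec (AllSize p Xs)
allSize? p []       = yes tt
allSize? p (X ∷ Xs) = (+ ∣ X ∣ ℤ.≟ p) ×-dec allSize? p Xs

SolvableIn : ℤ → OrientedGraph → ℕ → Set
SolvableIn p D m = ∃ λ Xs → MakesAcyclic p D Xs × length Xs ≡ m

toVec-of-length : ∀ {A : Set} {m} (xs : List A) → length xs ≡ m → ∃ λ (w : Vec A m) → toList w ≡ xs
toVec-of-length xs refl = fromList xs , toList∘fromList xs

solvableIn? : ∀ p D m → Dec (SolvableIn p D m)
solvableIn? p D m = Dec.map′
  (λ (w , solves) → toList w , solves , length-toList w)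
  (λ (Xs , solves , |Xs|≡m) → let w , w≡Xs = toVec-of-length Xs |Xs|≡m
                              in w , subst (MakesAcyclic p D) (sym w≡Xs) solves)
  (searchable-Vec anySubset? m
    (λ w → allSize? p (toList w) ×-dec ¬? (directedCycle? (applySeq (toList w) (arc D)))))

minimal : ∀ {P : Pred ℕ 0ℓ} → Decidable P → ∀ m → P m → ∃ λ k → P k × (∀ j → P j → k ≤ j)
minimal {P} P? m Pm = go m Pm (<-wellFounded m)
  where
    go : ∀ m → P m → Acc _<_ m → ∃ λ k → P k × (∀ j → P j → k ≤ j)
    go m Pm (acc smaller) with anyUpTo? P? m
    ... | yes (j , j<m , Pj) = go j Pj (smaller j<m)
    ... | no none            = m , Pm , λ j Pj → ≮⇒≥ (λ j<m → none (j , j<m , Pj))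

theorem1p6 : (D : OrientedGraph) (p : ℤ) → Invertible p D →
    ∃[ m ] (IsInv p D m × m ≤ arcCount D)
theorem1p6 D p (Xs , solves)
  with Ys , solvesY , |Ys|≤arcs ← short-solution p D Xs solves
  with m , optimum , least ← minimal (solvableIn? p D) (length Ys) (Ys , solvesY , refl)
  = m , (optimum , λ Ws solvesW → least (length Ws) (Ws , solvesW , refl))
  , ≤-trans (least (length Ys) (Ys , solvesY , refl)) |Ys|≤arcs
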